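{- Let $\$\notin\mathbb{F}_q$ be a new symbol and fix a total order $<$ on $\mathbb{F}_q\cup\{\$\}$ with $\$<a$ for all $a\in\mathbb{F}_q$. Let $\sigma\in\mathbb{F}_q^n$. Then $\sigma$ is a Lyndon word (with respect to the restriction of $<$ to $\mathbb{F}_q$) if and only if $\mathrm{Min}(ST_{n+2}(\sigma\sigma\$))=\sigma\sigma\$$.
   Context: Words are compared lexicographically. For $\sigma=\sigma_1\cdots\sigma_n$, $R_i(\sigma)=\sigma_i\cdots\sigma_n\sigma_1\cdots\sigma_{i-1}$, and $\sigma$ is a Lyndon word if $\sigma<R_i(\sigma)$ for all $2\le i\le n$. For a word $s$ and integer $m$, $ST_m(s)$ is the trie (rooted tree with edges labeled by symbols) containing exactly the suffixes of $s$ of length at least $m$, each suffix corresponding to the root-to-leaf path spelling it. $\mathrm{Min}(ST_m(s))$ is the word spelled by the path that starts at the root and, at each node, follows the outgoing edge labeled by the smallest symbol (with respect to $<$), until a leaf is reached. -}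

module Defs where

open import Level using (Level)
open import Data.Nat using (ℕ; _≤?_; _∸_)
open import Data.List using (List; []; _∷_; _++_; length; tails; filter; drop; take)
open import Data.List.Relation.Unary.All using (All)
open import Data.List.Membership.Propositional using (_∈_)
open import Relation.Binary.PropositionalEquality using (_≡_)
open import Data.Product using (Σ; _×_)
open import Relation.Nullary using (¬_)

data Lex< {A : Set} (_<_ : A → A → Set) : List A → List A → Set where
  nil<  : ∀ {y ys} → Lex< _<_ [] (y ∷ ys)
  here  : ∀ {x y xs ys} → x < y → Lex< _<_ (x ∷ xs) (y ∷ ys)
  there : ∀ {x xs ys} → Lex< _<_ xs ys → Lex< _<_ (x ∷ xs) (x ∷ ys)

-- R_i(σ) = σ_i ⋯ σ_n σ_1 ⋯ σ_{i-1}
rot : {A : Set} → ℕ → List A → List A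
rot i σ = drop (i ∸ 1) σ ++ take (i ∸ 1) σ

IsLyndon : {A : Set} (_<_ : A → A → Set) → List A → Set
IsLyndon _<_ σ = ∀ i → 2 Data.Nat.≤ i → i Data.Nat.≤ length σ → Lex< _<_ σ (rot i σ)

data Sym (A : Set) : Set where
  dollar : Sym A
  ch     : A → Sym A

data _<ˢ_ {A : Set} {_<_ : A → A → Set} : Sym A → Sym A → Set where
  $<ch  : ∀ {a} → _<ˢ_ {_<_ = _<_} dollar (ch a)
  ch<ch : ∀ {a b} → a < b → _<ˢ_ {_<_ = _<_} (ch a) (ch b)

SymLt : {A : Set} → (A → A → Set) → Sym A → Sym A → Set
SymLt _<_ = _<ˢ_ {_<_ = _<_}

-- The set of words stored in the trie ST_m(s): suffixes of s of length ≥ m.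
SuffixesAtLeast : {B : Set} → ℕ → List B → List B → Set
SuffixesAtLeast m s w = (Σ ℕ λ k → w ≡ drop k s) × (m Data.Nat.≤ length w)

-- Min of the trie whose root-to-leaf paths spell the words of the set W:
-- MinPath _<_ W p  means: starting at the root and repeatedly following the
-- outgoing edge with the smallest label until a leaf (node without children)
-- is reached spells p.  The subtrie below edge c stores {w | c ∷ w ∈ W}.
data MinPath {B : Set} (_<_ : B → B → Set) (W : List B → Set) : List B → Set where
  leaf : (∀ w → W w → w ≡ []) → MinPath _<_ W []
  step : ∀ {c p} (w : List B) → W (c ∷ w)
       → (∀ d v → W (d ∷ v) → ¬ (d < c))
       → MinPath _<_ (λ v → W (c ∷ v)) p
       → MinPath _<_ W (c ∷ p)

module Submission where

-- Write  s = σσ$  for a word σ of length N ≥ 1.  The suffixes of s of length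
-- at least N + 2 are exactly  s_k = (drop k σ) σ $  for k < N.  All of them end
-- in the unique letter $, so no one is a proper prefix of another; for such a
-- prefix-free set the greedy minimal path of its trie spells precisely the
-- lexicographically least member.  Hence the theorem amounts to: σ is Lyndon
-- iff  s ≤ s_k  for all 0 < k < N.
--
-- The heart is a comparison of s = (vu)(vu)$ with its suffix u(vu)$, v ≠ [],
-- which both begin with N letters, namely vu resp. the rotation uv:
--   * vu < uv  forces  s < u(vu)$;
--   * uv < vu  forces  u(vu)$ < s;
--   * uv = vu  gives  s = (u·vu)v$  versus  u(vu)$ = (u·vu)$, so  u(vu)$ < s.

open import Defs
open import Data.Nat using (ℕ; _≤_; _+_)
open import Data.Fin using (Fin)
open import Data.Vec using (Vec; toList)
open import Data.List using (List; map; _++_; [_])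
open import Relation.Binary.PropositionalEquality using (_≡_)
open import Relation.Binary.Structures using (IsStrictTotalOrder)
open import Function.Bundles using (_⇔_)

open import Data.Nat using (zero; suc; s≤s; z≤n; _<_; _∸_; _<?_)
open import Data.Nat.Properties
  using (≤-trans; ≤-reflexive; <⇒≤; +-comm; +-assoc; +-monoʳ-≤; +-cancelˡ-≤; ≮⇒≥;
         ∸-monoʳ-≤; m+n∸m≡n; m+n≤o⇒m≤o∸n; m+n≤o⇒n≤o; suc-injective)
open import Data.List using ([]; _∷_; length; drop; take)
open import Data.List.Properties
  using (map-++; ++-assoc; length-map; length-++; length-++-comm; take++drop≡id;
         drop-map; drop-[]; length-drop; ∷-injectiveʳ)
open import Data.Vec.Properties using (length-toList)
open import Relation.Binary.PropositionalEquality
  using (refl; sym; trans; cong; cong₂; subst; subst₂; module ≡-Reasoning)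
open import Relation.Binary.Definitions using (Asymmetric; Trichotomous; tri<; tri≈; tri>)
open import Data.Product using (Σ; _×_; _,_)
open import Data.Sum using (_⊎_; inj₁; inj₂)
open import Data.Empty using (⊥-elim)
open import Relation.Nullary using (¬_; yes; no)
open import Function.Bundles using (mk⇔)

module Lexicographic {B : Set} {_<ᴮ_ : B → B → Set} where

  lex-++ : ∀ {a b} x y → Lex< _<ᴮ_ a b → length a ≡ length b
         → Lex< _<ᴮ_ (a ++ x) (b ++ y)
  lex-++ x y nil<      ()
  lex-++ x y (here p)  _ = here p
  lex-++ x y (there l) e = there (lex-++ x y l (suc-injective e))

  lex-letter : ∀ X {c d Y} → c <ᴮ d → Lex< _<ᴮ_ (X ++ [ c ]) (X ++ d ∷ Y)
  lex-letter []      c<d = here c<d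
  lex-letter (x ∷ X) c<d = there (lex-letter X c<d)

  lex-asym : Asymmetric _<ᴮ_ → Asymmetric (Lex< _<ᴮ_)
  lex-asym asym nil<      ()
  lex-asym asym (here p)  (here q)  = asym p q
  lex-asym asym (here p)  (there _) = asym p p
  lex-asym asym (there _) (here q)  = asym q q
  lex-asym asym (there p) (there q) = lex-asym asym p q

  lex-irrefl : Asymmetric _<ᴮ_ → ∀ {a} → ¬ Lex< _<ᴮ_ a a
  lex-irrefl asym lt = lex-asym asym lt lt

  lex-trichotomy : Trichotomous _≡_ _<ᴮ_ → ∀ a b → length a ≡ length b
                 → Lex< _<ᴮ_ a b ⊎ a ≡ b ⊎ Lex< _<ᴮ_ b a
  lex-trichotomy compare []      []      _ = inj₂ (inj₁ refl)
  lex-trichotomy compare (x ∷ a) (y ∷ b) e with compare x y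
  ... | tri< x<y _ _ = inj₁ (here x<y)
  ... | tri> _ _ y<x = inj₂ (inj₂ (here y<x))
  ... | tri≈ _ refl _ with lex-trichotomy compare a b (suc-injective e)
  ...   | inj₁ a<b         = inj₁ (there a<b)
  ...   | inj₂ (inj₁ refl) = inj₂ (inj₁ refl)
  ...   | inj₂ (inj₂ b<a)  = inj₂ (inj₂ (there b<a))

lex-map : ∀ {B C : Set} {_<ᴮ_ : B → B → Set} {_<ᶜ_ : C → C → Set} (f : B → C)
        → (∀ {b b′} → b <ᴮ b′ → f b <ᶜ f b′)
        → ∀ {a a′} → Lex< _<ᴮ_ a a′ → Lex< _<ᶜ_ (map f a) (map f a′)
lex-map f mono nil<      = nil<
lex-map f mono (here p)  = here (mono p)
lex-map f mono (there l) = there (lex-map f mono l)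

module MinimalPath {B : Set} where

  PrefixFree : (List B → Set) → Set
  PrefixFree W = ∀ u r → W u → W (u ++ r) → r ≡ []

  NoneBelow : (B → B → Set) → (List B → Set) → List B → Set
  NoneBelow _<ᴮ_ W p = ∀ w → W w → ¬ Lex< _<ᴮ_ w p

  prefixFree-⊆ : ∀ {V W} → (∀ w → W w → V w) → PrefixFree V → PrefixFree W
  prefixFree-⊆ W⊆V pf u r Wu Wur = pf u r (W⊆V u Wu) (W⊆V (u ++ r) Wur)

  prefixFree-child : ∀ {W} c → PrefixFree W → PrefixFree (λ v → W (c ∷ v))
  prefixFree-child c pf u = pf (c ∷ u)

  minPath⇒noneBelow : ∀ {_<ᴮ_ W p} → PrefixFree W → MinPath _<ᴮ_ W p → NoneBelow _<ᴮ_ W p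
  minPath⇒noneBelow pf (leaf _) w Ww ()
  minPath⇒noneBelow pf (step w′ Wcw′ _ _) [] W[] nil<
    with () ← pf [] _ W[] Wcw′
  minPath⇒noneBelow pf (step _ _ minimal _) (d ∷ v) Wdv (here d<c) = minimal d v Wdv d<c
  minPath⇒noneBelow pf (step {c = c} _ _ _ mp) (_ ∷ v) Wcv (there v<p) =
    minPath⇒noneBelow (prefixFree-child c pf) mp v Wcv v<p

  noneBelow⇒minPath : ∀ {_<ᴮ_ W} p → PrefixFree W → W p → NoneBelow _<ᴮ_ W p
                    → MinPath _<ᴮ_ W p
  noneBelow⇒minPath []      pf Wp _ = leaf (λ w Ww → pf [] w Wp Ww)
  noneBelow⇒minPath (c ∷ p) pf Wp least =
    step p Wp (λ d v Wdv d<c → least (d ∷ v) Wdv (here d<c))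
      (noneBelow⇒minPath p (prefixFree-child c pf) Wp
        (λ v Wcv v<p → least (c ∷ v) Wcv (there v<p)))

open Lexicographic
open MinimalPath

drop-++ˡ : ∀ {B : Set} k (a b : List B) → k ≤ length a → drop k (a ++ b) ≡ drop k a ++ b
drop-++ˡ zero    a       b _         = refl
drop-++ˡ (suc k) (x ∷ a) b (s≤s k≤a) = drop-++ˡ k a b k≤a

module DollarWords {A : Set} where

  _·$ : List A → List (Sym A)
  t ·$ = map ch t ++ [ dollar ]

  square : List A → List (Sym A)
  square σ = map ch σ ++ σ ·$

  Terminated : List (Sym A) → Set
  Terminated w = Σ (List A) λ t → w ≡ t ·$

  ·$-++ : ∀ a b → map ch a ++ b ·$ ≡ (a ++ b) ·$
  ·$-++ a b = trans (sym (++-assoc (map ch a) (map ch b) [ dollar ]))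
                    (cong (_++ [ dollar ]) (sym (map-++ ch a b)))

  -- $ occurs only at the end, so $-terminated words are prefix-free.
  terminated-prefixFree : PrefixFree Terminated
  terminated-prefixFree u r (a , refl) (b , e) = unique-end a b e
    where
      unique-end : ∀ a b → a ·$ ++ r ≡ b ·$ → r ≡ []
      unique-end []      []      e = ∷-injectiveʳ e
      unique-end []      (y ∷ b) ()
      unique-end (x ∷ a) []      ()
      unique-end (x ∷ a) (y ∷ b) e = unique-end a b (∷-injectiveʳ e)

  drop-terminated : ∀ k t → drop k (t ·$) ≡ [] ⊎ Terminated (drop k (t ·$))
  drop-terminated zero    t       = inj₂ (t , refl)
  drop-terminated (suc k) []      = inj₁ (drop-[] k)
  drop-terminated (suc k) (x ∷ t) = drop-terminated k t

  drop-square : ∀ k σ → k ≤ length σ → drop k (square σ) ≡ map ch (drop k σ) ++ σ ·$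
  drop-square k σ k≤σ =
    trans (drop-++ˡ k (map ch σ) (σ ·$) (subst (k ≤_) (sym (length-map ch σ)) k≤σ))
          (cong (_++ σ ·$) (drop-map k σ))

  length-square : ∀ σ → length (square σ) ≡ length σ + (length σ + 1)
  length-square σ =
    trans (length-++ (map ch σ))
          (cong₂ _+_ (length-map ch σ)
                     (trans (length-++ (map ch σ)) (cong (_+ 1) (length-map ch σ))))

long-remainder⇒small : ∀ N k → N + 2 ≤ (N + (N + 1)) ∸ k → k < N
long-remainder⇒small N k long with k <? N
... | yes k<N = k<N
... | no  k≮N = ⊥-elim (2≰1 (+-cancelˡ-≤ N 2 1 (≤-trans long remainder≤N+1)))
  where
    remainder≤N+1 : (N + (N + 1)) ∸ k ≤ N + 1
    remainder≤N+1 = ≤-trans (∸-monoʳ-≤ (N + (N + 1)) (≮⇒≥ k≮N))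
                            (≤-reflexive (m+n∸m≡n N (N + 1)))
    2≰1 : ¬ 2 ≤ 1
    2≰1 (s≤s ())

small⇒long-remainder : ∀ N k → k < N → N + 2 ≤ (N + (N + 1)) ∸ k
small⇒long-remainder N k k<N = m+n≤o⇒m≤o∸n (N + 2)
  (subst (_≤ N + (N + 1)) (sym (+-assoc N 2 k))
         (+-monoʳ-≤ N (subst (suc (suc k) ≤_) (+-comm 1 N) (s≤s k<N))))

module Doubling {A : Set} (_≺_ : A → A → Set) (sto : IsStrictTotalOrder _≡_ _≺_) where
  open IsStrictTotalOrder sto using (compare; asym)
  open DollarWords {A}

  infix 4 _⊏_
  _⊏_ : List (Sym A) → List (Sym A) → Set
  _⊏_ = Lex< (SymLt _≺_)

  sym-asym : Asymmetric (SymLt _≺_)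
  sym-asym $<ch        ()
  sym-asym (ch<ch a<b) (ch<ch b<a) = asym a<b b<a

  extend : ∀ {a b} x y → Lex< _≺_ a b → length a ≡ length b → map ch a ++ x ⊏ map ch b ++ y
  extend {a} {b} x y a<b e =
    lex-++ x y (lex-map ch ch<ch a<b)
           (trans (length-map ch a) (trans e (sym (length-map ch b))))

  rotation-prefix : ∀ u v → map ch u ++ (v ++ u) ·$ ≡ map ch (u ++ v) ++ u ·$
  rotation-prefix u v = begin
    map ch u ++ (v ++ u) ·$            ≡⟨ cong (map ch u ++_) (sym (·$-++ v u)) ⟩
    map ch u ++ (map ch v ++ u ·$)     ≡⟨ sym (++-assoc (map ch u) (map ch v) (u ·$)) ⟩
    (map ch u ++ map ch v) ++ u ·$     ≡⟨ cong (_++ u ·$) (sym (map-++ ch u v)) ⟩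
    map ch (u ++ v) ++ u ·$            ∎
    where open ≡-Reasoning

  rotation-above : ∀ {σ} u v → v ++ u ≡ σ → Lex< _≺_ σ (u ++ v)
                 → square σ ⊏ (map ch u ++ σ ·$)
  rotation-above u v refl σ<uv =
    subst (square (v ++ u) ⊏_) (sym (rotation-prefix u v))
          (extend ((v ++ u) ·$) (u ·$) σ<uv (length-++-comm v u))

  rotation-below : ∀ {σ} u v → v ++ u ≡ σ → Lex< _≺_ (u ++ v) σ
                 → (map ch u ++ σ ·$) ⊏ square σ
  rotation-below u v refl uv<σ =
    subst (_⊏ square (v ++ u)) (sym (rotation-prefix u v))
          (extend (u ·$) ((v ++ u) ·$) uv<σ (length-++-comm u v))

  -- If uv = vu = σ then σσ = uσv, so  u σ $  and  σσ$ = uσ v$  first differ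
  -- where the former has $ and the latter the first letter of v ≠ [].
  rotation-periodic : ∀ {σ} u v → v ++ u ≡ σ → ¬ v ≡ [] → u ++ v ≡ σ
                    → (map ch u ++ σ ·$) ⊏ square σ
  rotation-periodic u []      _    v≢[] _ = ⊥-elim (v≢[] refl)
  rotation-periodic u (y ∷ v) refl _ uv≡σ =
    subst₂ _⊏_ (sym (·$-++ u σ)) (sym square≡) (lex-letter (map ch (u ++ σ)) $<ch)
    where
      open ≡-Reasoning
      σ : List A
      σ = y ∷ v ++ u
      σσ≡uσv : σ ++ σ ≡ (u ++ σ) ++ y ∷ v
      σσ≡uσv = begin
        σ ++ σ                  ≡⟨ cong (_++ σ) (sym uv≡σ) ⟩
        (u ++ y ∷ v) ++ σ       ≡⟨ ++-assoc u (y ∷ v) σ ⟩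
        u ++ (y ∷ v ++ σ)       ≡⟨ cong (λ τ → u ++ (y ∷ v ++ τ)) (sym uv≡σ) ⟩
        u ++ (y ∷ v ++ u ++ y ∷ v) ≡⟨ cong (u ++_) (sym (++-assoc (y ∷ v) u (y ∷ v))) ⟩
        u ++ (σ ++ y ∷ v)       ≡⟨ sym (++-assoc u σ (y ∷ v)) ⟩
        (u ++ σ) ++ y ∷ v       ∎
      square≡ : square σ ≡ map ch (u ++ σ) ++ ch y ∷ v ·$
      square≡ = begin
        square σ                          ≡⟨ ·$-++ σ σ ⟩
        (σ ++ σ) ·$                       ≡⟨ cong _·$ σσ≡uσv ⟩
        ((u ++ σ) ++ y ∷ v) ·$            ≡⟨ sym (·$-++ (u ++ σ) (y ∷ v)) ⟩
        map ch (u ++ σ) ++ ch y ∷ v ·$    ∎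

  rotation-dichotomy : ∀ {σ} u v → v ++ u ≡ σ → ¬ v ≡ []
                     → Lex< _≺_ σ (u ++ v) ⊎ (map ch u ++ σ ·$) ⊏ square σ
  rotation-dichotomy u v refl v≢[]
    with lex-trichotomy compare (v ++ u) (u ++ v) (length-++-comm v u)
  ... | inj₁ σ<uv         = inj₁ σ<uv
  ... | inj₂ (inj₁ σ≡uv)  = inj₂ (rotation-periodic u v refl v≢[] (sym σ≡uv))
  ... | inj₂ (inj₂ uv<σ)  = inj₂ (rotation-below u v refl uv<σ)

  Suffixes : List A → List (Sym A) → Set
  Suffixes σ = SuffixesAtLeast (length σ + 2) (square σ)

  length-drop-square : ∀ k σ → length (drop k (square σ)) ≡ (length σ + (length σ + 1)) ∸ k
  length-drop-square k σ = trans (length-drop k (square σ)) (cong (_∸ k) (length-square σ))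

  suffix-index : ∀ σ {w} → Suffixes σ w → Σ ℕ λ k → k < length σ × w ≡ drop k (square σ)
  suffix-index σ ((k , refl) , long) =
    k , long-remainder⇒small (length σ) k
          (subst (length σ + 2 ≤_) (length-drop-square k σ) long) , refl

  index-suffix : ∀ σ k → k < length σ → Suffixes σ (drop k (square σ))
  index-suffix σ k k<σ =
    (k , refl) , subst (length σ + 2 ≤_) (sym (length-drop-square k σ))
                       (small⇒long-remainder (length σ) k k<σ)

  -- Every stored word ends in $, hence the trie stores a prefix-free set.
  suffixes-prefixFree : ∀ σ → PrefixFree (Suffixes σ)
  suffixes-prefixFree σ = prefixFree-⊆ terminated terminated-prefixFree
    where
      terminated : ∀ w → Suffixes σ w → Terminated w
      terminated w ((k , refl) , long) with drop-terminated k (σ ++ σ)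
      ... | inj₂ t     = subst (λ τ → Terminated (drop k τ)) (sym (·$-++ σ σ)) t
      ... | inj₁ empty with () ← m+n≤o⇒n≤o (length σ) (≤-trans long (≤-reflexive
                                    (trans (cong (λ τ → length (drop k τ)) (·$-++ σ σ))
                                           (cong length empty))))

  shift-above : ∀ σ k → k ≤ length σ → Lex< _≺_ σ (rot (suc k) σ)
              → square σ ⊏ drop k (square σ)
  shift-above σ k k≤σ σ<rot =
    subst (square σ ⊏_) (sym (drop-square k σ k≤σ))
          (rotation-above (drop k σ) (take k σ) (take++drop≡id k σ) σ<rot)

  lyndon⇒noneBelow : ∀ σ → IsLyndon _≺_ σ → NoneBelow (SymLt _≺_) (Suffixes σ) (square σ)
  lyndon⇒noneBelow σ lyndon w member w<s with suffix-index σ member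
  ... | zero , _ , refl = lex-irrefl sym-asym w<s
  ... | suc k , k<σ , refl =
    lex-asym sym-asym (shift-above σ (suc k) (<⇒≤ k<σ) (lyndon (suc (suc k)) (s≤s (s≤s z≤n)) k<σ)) w<s

  -- Conversely, if no stored shift lies below σσ$, the dichotomy leaves only
  -- σ < R_i(σ) for each 2 ≤ i ≤ |σ|.  (The empty word is vacuously Lyndon.)
  noneBelow⇒lyndon : ∀ σ → NoneBelow (SymLt _≺_) (Suffixes σ) (square σ) → IsLyndon _≺_ σ
  noneBelow⇒lyndon []      _     zero          ()
  noneBelow⇒lyndon []      _     (suc i)       _ ()
  noneBelow⇒lyndon (x ∷ σ) _     (suc zero)    (s≤s ()) _
  noneBelow⇒lyndon (x ∷ σ) least (suc (suc k)) _ k<σ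
    with rotation-dichotomy (drop (suc k) (x ∷ σ)) (take (suc k) (x ∷ σ))
                            (take++drop≡id (suc k) (x ∷ σ)) (λ ())
  ... | inj₁ σ<rot    = σ<rot
  ... | inj₂ shift<s  =
    ⊥-elim (least _ (index-suffix (x ∷ σ) (suc k) k<σ)
                  (subst (_⊏ square (x ∷ σ)) (sym (drop-square (suc k) (x ∷ σ) (<⇒≤ k<σ))) shift<s))

  lyndon⇔minPath : ∀ {n} σ → length σ ≡ n → 1 ≤ n
                 → IsLyndon _≺_ σ ⇔ MinPath (SymLt _≺_) (SuffixesAtLeast (n + 2) (square σ)) (square σ)
  lyndon⇔minPath σ refl 0<σ = mk⇔
    (λ lyndon → noneBelow⇒minPath (square σ) (suffixes-prefixFree σ)
                  (index-suffix σ 0 0<σ) (lyndon⇒noneBelow σ lyndon))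
    (λ minPath → noneBelow⇒lyndon σ (minPath⇒noneBelow (suffixes-prefixFree σ) minPath))

lemma5 : (q : ℕ) (_<_ : Fin q → Fin q → Set) → IsStrictTotalOrder _≡_ _<_
       → (n : ℕ) → 1 ≤ n → (σ : Vec (Fin q) n)
       → IsLyndon _<_ (toList σ)
         ⇔ MinPath (SymLt _<_)
                   (SuffixesAtLeast (n + 2) (map ch (toList σ) ++ map ch (toList σ) ++ [ dollar ]))
                   (map ch (toList σ) ++ map ch (toList σ) ++ [ dollar ])
lemma5 q _<_ sto n 0<n σ = Doubling.lyndon⇔minPath _<_ sto (toList σ) (length-toList σ) 0<n
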